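{- Let $q\geq 2$. If $C$ is a completely regular code in $H(3,q)$ with covering radius $1$ fulfilling the strong clique property, then $\lambda_2(3,q)$ is an eigenvalue of $C$, i.e. $\beta+\gamma=2q$.
   Context: Let $\mathcal{A}$ be a set of size $q$; $H(3,q)$ has vertex set $\mathcal{A}^3$, tuples adjacent iff they differ in exactly one position; it is $3(q-1)$-regular with eigenvalues $\lambda_i(3,q)=3(q-1)-qi$. A set $C$ of vertices is a completely regular code with covering radius $1$ if $C$ is a nonempty proper subset and there are integers $\beta,\gamma\geq1$ such that every vertex of $C$ has exactly $\beta$ neighbours outside $C$ and every vertex outside $C$ has exactly $\gamma$ neighbours in $C$; its eigenvalues are $3(q-1)$ and $3(q-1)-(\beta+\gamma)$. A maximum clique of codirection $i\in\{1,2,3\}$ is a set of $q$ tuples agreeing in all positions except position $i$ and taking all $q$ symbols in position $i$. $C$ fulfills the strong clique property if $C$ is a union of pairwise disjoint maximum cliques among which there are cliques of each of the three codirections. -}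

module Defs where

open import Data.Nat using (ℕ; _≥_; _+_; _*_)
open import Data.Fin using (Fin)
open import Data.Fin.Properties using (_≟_)
open import Data.Bool using (Bool; true; false)
open import Data.List using (List; length; filter; allFin; cartesianProduct; map)
open import Data.List.Membership.Propositional using (_∈_)
open import Data.List.Relation.Unary.Any using (Any)
open import Data.Product using (_×_; _,_; ∃; ∃-syntax; Σ-syntax)
open import Relation.Binary.PropositionalEquality using (_≡_)
open import Relation.Nullary using (¬_; Dec; yes; no)
open import Relation.Nullary.Decidable using (¬?; _×-dec_)

Vertex : ℕ → Set
Vertex q = Fin q × Fin q × Fin q

vertices : (q : ℕ) → List (Vertex q)
vertices q = cartesianProduct (allFin q) (cartesianProduct (allFin q) (allFin q))

coord : ∀ {q} → Vertex q → Fin 3 → Fin q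
coord (a , b , c) Fin.zero = a
coord (a , b , c) (Fin.suc Fin.zero) = b
coord (a , b , c) (Fin.suc (Fin.suc Fin.zero)) = c

dist : ∀ {q} → Vertex q → Vertex q → ℕ
dist x y = length (filter (λ i → ¬? (coord x i ≟ coord y i)) (allFin 3))

Adj : ∀ {q} → Vertex q → Vertex q → Set
Adj x y = dist x y ≡ 1

adj? : ∀ {q} (x y : Vertex q) → Dec (Adj x y)
adj? x y = dist x y Data.Nat.≟ 1
  where import Data.Nat

Code : ℕ → Set
Code q = Vertex q → Bool

inC? : ∀ {q} (C : Code q) (b : Bool) (y : Vertex q) → Dec (C y ≡ b)
inC? C b y = Data.Bool._≟_ (C y) b
  where import Data.Bool

nbrsWith : ∀ {q} → Code q → Bool → Vertex q → ℕ
nbrsWith {q} C b x = length (filter (λ y → adj? x y ×-dec inC? C b y) (vertices q))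

IsCRC1 : ∀ {q} → Code q → ℕ → ℕ → Set
IsCRC1 {q} C β γ =
  (∃[ x ] C x ≡ true) × (∃[ y ] C y ≡ false) × β ≥ 1 × γ ≥ 1
  × (∀ x → C x ≡ true → nbrsWith C false x ≡ β)
  × (∀ x → C x ≡ false → nbrsWith C true x ≡ γ)

-- A maximum clique is described by its codirection i and a base tuple x:
-- its vertices are the tuples agreeing with x in all positions except i
-- (it then automatically contains all q symbols in position i).
Clique : ℕ → Set
Clique q = Fin 3 × Vertex q

codir : ∀ {q} → Clique q → Fin 3
codir (i , _) = i

InClique : ∀ {q} → Vertex q → Clique q → Set
InClique y (i , x) = ∀ j → ¬ (j ≡ i) → coord y j ≡ coord x j

StrongClique : ∀ {q} → Code q → Set
StrongClique {q} C = Σ[ K ∈ List (Clique q) ]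
  (∀ y → C y ≡ true → Any (InClique y) K)
  × (∀ y k → k ∈ K → InClique y k → C y ≡ true)
  × (∀ k k′ → k ∈ K → k′ ∈ K → (∃[ y ] (InClique y k × InClique y k′)) →
       (∀ y → InClique y k → InClique y k′) × (∀ y → InClique y k′ → InClique y k))
  × (∀ i → Any (λ k → codir k ≡ i) K)

-- Let f be the indicator of C, ℓᵢ its line sums, Pᵢ its plane sums, and L(x) = ℓ₀ + ℓ₁ + ℓ₂ the
-- total over the three lines through x. Counting neighbours, complete regularity says exactly that
-- L = K·f + γ with K = 3q − β − γ. Summing this over the line through (a,b,c) in direction 0 gives
-- P₁(b) + P₂(c) = (K − q)·ℓ₀(b,c) + qγ, and summing over all three lines gives
-- 2(P₀(a) + P₁(b) + P₂(c)) = (K − q)·L + 3qγ, so the planes through x have total weight depending only on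
-- whether x ∈ C. Cliques of codirections 1 and 2 lie in C, so P₁ and P₂ are constant and hence so is
-- (K − q)·ℓ₀. A clique of codirection 0 is a line with ℓ₀ = q, while the line through a vertex outside C has
-- ℓ₀ < q; therefore K − q = 2q − β − γ = 0.

module Submission where

open import Defs
open import Data.Bool.Base using (Bool; true; false; not; _∧_)
import Data.Bool.Properties as Bool
open import Data.Empty using (⊥-elim)
open import Data.Fin.Base using (Fin; zero; suc)
open import Data.Fin.Properties using (_≟_)
open import Data.Integer.Base using (ℤ; +_; 0ℤ; 1ℤ; _+_; _*_; _-_; _≤_; _<_; +≤+; +<+; ≢-nonZero)
import Data.Integer.Properties as ℤ
open import Data.Integer.Tactic.RingSolver using (solve-∀)
open import Data.List.Base using (List; []; _∷_; _++_; map; filter; length; tabulate; allFin; cartesianProduct)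
import Data.List.Properties as List
open import Data.Nat as ℕ using (ℕ; _≥_; z≤n; s≤s)
open import Data.Product.Base using (_×_; _,_; ∃-syntax)
open import Data.List.Membership.Propositional using (find)
open import Function.Base using (_∘_; id)
open import Relation.Binary.PropositionalEquality
open import Relation.Nullary using (¬_; does; yes; no)
open import Relation.Nullary.Decidable using (_×-dec_; ¬?; dec-false)
open import Relation.Unary using (Pred; Decidable)
open import Algebra.Properties.AbelianGroup ℤ.+-0-abelianGroup using (∙-cancelˡ; ∙-cancelʳ)
open import Algebra.Properties.Semiring.Sum ℤ.+-*-semiring
  using (sum-syntax; sum-cong-≗; ∑-distrib-+; ∑-comm; *-distribˡ-sum; *-distribʳ-sum)

open ≡-Reasoning

χ : Bool → ℤ
χ true = 1ℤ
χ false = 0ℤ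

χ-∧ : ∀ s t → χ (s ∧ t) ≡ χ s * χ t
χ-∧ true t = sym (ℤ.*-identityˡ (χ t))
χ-∧ false t = refl

χ-∧₃ : ∀ s t u → χ (s ∧ t ∧ u) ≡ χ s * (χ t * χ u)
χ-∧₃ s t u = trans (χ-∧ s (t ∧ u)) (cong (_*_ (χ s)) (χ-∧ t u))

χ≤1 : ∀ s → χ s ≤ 1ℤ
χ≤1 true = ℤ.≤-refl
χ≤1 false = +≤+ z≤n

δ : ∀ {n} → Fin n → Fin n → ℤ
δ i j = χ (does (i ≟ j))

∑-const : ∀ n x → ∑[ i < n ] x ≡ + n * x
∑-const ℕ.zero x = refl
∑-const (ℕ.suc n) x = trans (cong (_+_ x) (∑-const n x)) (sym (ℤ.suc-* (+ n) x))

∑-1 : ∀ n → ∑[ i < n ] 1ℤ ≡ + n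
∑-1 n = trans (∑-const n 1ℤ) (ℤ.*-identityʳ (+ n))

∑-*ˡ : ∀ {n} x (f : Fin n → ℤ) → ∑[ j < n ] (x * f j) ≡ x * ∑[ j < n ] f j
∑-*ˡ x f = sym (*-distribˡ-sum x f)

∑-distrib-+₃ : ∀ {n} (f g h : Fin n → ℤ) →
  ∑[ i < n ] (f i + g i + h i) ≡ ∑[ i < n ] f i + ∑[ i < n ] g i + ∑[ i < n ] h i
∑-distrib-+₃ f g h =
  trans (∑-distrib-+ (λ i → f i + g i) h) (cong (λ s → s + ∑[ i < _ ] h i) (∑-distrib-+ f g))

∑-affine : ∀ {n} (g : Fin n → ℤ) K γ → ∑[ i < n ] (g i * K + γ) ≡ ∑[ i < n ] g i * K + + n * γ
∑-affine {n} g K γ = trans (∑-distrib-+ (λ i → g i * K) (λ _ → γ))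
                           (cong₂ _+_ (sym (*-distribʳ-sum K g)) (∑-const n γ))

∑-complement : ∀ {n} (f : Fin n → ℤ) → ∑[ i < n ] (1ℤ - f i) ≡ + n - ∑[ i < n ] f i
∑-complement {ℕ.zero} f = refl
∑-complement {ℕ.suc n} f =
  trans (cong (_+_ (1ℤ - f zero)) (∑-complement (f ∘ suc))) (regroup (f zero) (∑[ i < n ] f (suc i)) (+ n))
  where
  regroup : ∀ x s m → (1ℤ - x) + (m - s) ≡ (1ℤ + m) - (x + s)
  regroup = solve-∀

∑-δ : ∀ {n} i (f : Fin n → ℤ) → ∑[ j < n ] (δ i j * f j) ≡ f i
∑-δ {ℕ.suc n} zero f = begin
  1ℤ * f zero + ∑[ j < n ] (0ℤ * f (suc j))
    ≡⟨ cong₂ _+_ (ℤ.*-identityˡ (f zero)) (trans (∑-const n 0ℤ) (ℤ.*-zeroʳ (+ n))) ⟩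
  f zero + 0ℤ                                ≡⟨ ℤ.+-identityʳ (f zero) ⟩
  f zero                                     ∎
∑-δ (suc i) f = trans (ℤ.+-identityˡ _) (∑-δ i (f ∘ suc))

∑-*δ : ∀ {n} x i (f : Fin n → ℤ) → ∑[ j < n ] (x * (δ i j * f j)) ≡ x * f i
∑-*δ x i f = trans (∑-*ˡ x (λ j → δ i j * f j)) (cong (_*_ x) (∑-δ i f))

∑-mono-≤ : ∀ {n} {f g : Fin n → ℤ} → (∀ i → f i ≤ g i) → ∑[ i < n ] f i ≤ ∑[ i < n ] g i
∑-mono-≤ {ℕ.zero} f≤g = ℤ.≤-refl
∑-mono-≤ {ℕ.suc n} f≤g = ℤ.+-mono-≤ (f≤g zero) (∑-mono-≤ (f≤g ∘ suc))

∑-mono-< : ∀ {n} {f g : Fin n → ℤ} → (∀ i → f i ≤ g i) → ∀ j → f j < g j → ∑[ i < n ] f i < ∑[ i < n ] g i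
∑-mono-< f≤g zero fj<gj = ℤ.+-mono-<-≤ fj<gj (∑-mono-≤ (f≤g ∘ suc))
∑-mono-< f≤g (suc j) fj<gj = ℤ.+-mono-≤-< (f≤g zero) (∑-mono-< (f≤g ∘ suc) j fj<gj)

∑-χ-all : ∀ {n} (g : Fin n → Bool) → (∀ i → g i ≡ true) → ∑[ i < n ] χ (g i) ≡ + n
∑-χ-all {n} g all = trans (sum-cong-≗ (cong χ ∘ all)) (∑-1 n)

∑-χ-< : ∀ {n} (g : Fin n → Bool) i → g i ≡ false → ∑[ i < n ] χ (g i) < + n
∑-χ-< {n} g i gi≡false = subst (∑[ j < n ] χ (g j) <_) (∑-1 n)
  (∑-mono-< {g = λ _ → 1ℤ} (χ≤1 ∘ g) i (subst (λ s → χ s < 1ℤ) (sym gi≡false) (+<+ (s≤s z≤n))))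

module _ {a ℓ} {A : Set a} {P : Pred A ℓ} (P? : Decidable P) where

  length-filter-∷ : ∀ x xs → + length (filter P? (x ∷ xs)) ≡ χ (does (P? x)) + + length (filter P? xs)
  length-filter-∷ x xs with does (P? x)
  ... | true = refl
  ... | false = refl

  length-filter-++ : ∀ xs ys → + length (filter P? (xs ++ ys)) ≡ + length (filter P? xs) + + length (filter P? ys)
  length-filter-++ xs ys = begin
    + length (filter P? (xs ++ ys))                   ≡⟨ cong (λ zs → + length zs) (List.filter-++ P? xs ys) ⟩
    + length (filter P? xs ++ filter P? ys)           ≡⟨ cong +_ (List.length-++ (filter P? xs)) ⟩
    + (length (filter P? xs) ℕ.+ length (filter P? ys)) ≡⟨ ℤ.pos-+ (length (filter P? xs)) _ ⟩
    + length (filter P? xs) + + length (filter P? ys) ∎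

  length-filter-tabulate : ∀ {n} (f : Fin n → A) → + length (filter P? (tabulate f)) ≡ ∑[ i < n ] χ (does (P? (f i)))
  length-filter-tabulate {ℕ.zero} f = refl
  length-filter-tabulate {ℕ.suc n} f =
    trans (length-filter-∷ (f zero) _) (cong (_+_ (χ (does (P? (f zero))))) (length-filter-tabulate (f ∘ suc)))

length-filter-map : ∀ {a b ℓ} {A : Set a} {B : Set b} {P : Pred B ℓ} (P? : Decidable P) (g : A → B) xs →
  length (filter P? (map g xs)) ≡ length (filter (P? ∘ g) xs)
length-filter-map P? g [] = refl
length-filter-map P? g (x ∷ xs) with does (P? (g x))
... | true = cong ℕ.suc (length-filter-map P? g xs)
... | false = length-filter-map P? g xs

length-filter-cartesianProduct : ∀ {a b ℓ} {A : Set a} {B : Set b} {P : Pred (A × B) ℓ} (P? : Decidable P) {n}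
  (f : Fin n → A) (ys : List B) →
  + length (filter P? (cartesianProduct (tabulate f) ys)) ≡ ∑[ i < n ] (+ length (filter (P? ∘ (f i ,_)) ys))
length-filter-cartesianProduct P? {ℕ.zero} f ys = refl
length-filter-cartesianProduct P? {ℕ.suc n} f ys =
  trans (length-filter-++ P? (map (f zero ,_) ys) _)
        (cong₂ _+_ (cong +_ (length-filter-map P? (f zero ,_) ys))
                   (length-filter-cartesianProduct P? (f ∘ suc) ys))

length-filter-vertices : ∀ {q ℓ} {P : Pred (Vertex q) ℓ} (P? : Decidable P) →
  + length (filter P? (vertices q)) ≡ ∑[ a < q ] ∑[ b < q ] ∑[ c < q ] χ (does (P? (a , b , c)))
length-filter-vertices P? =
  trans (length-filter-cartesianProduct P? id _) (sum-cong-≗ λ a →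
  trans (length-filter-cartesianProduct (P? ∘ (a ,_)) id (allFin _)) (sum-cong-≗ λ b →
  length-filter-tabulate (λ c → P? (a , b , c)) id))

-- s, t, u say whether y agrees with x in each coordinate, n is their Hamming distance (the right-hand side
-- is the unfolded ∑[ i < 3 ] of the disagreements) and g whether y has a property that x lacks.
χ-distance-one : ∀ {n} s t u g → + n ≡ χ (not s) + (χ (not t) + (χ (not u) + 0ℤ)) → (s ∧ t ∧ u) ∧ g ≡ false →
  χ (does (n ℕ.≟ 1) ∧ g) ≡ χ (t ∧ u ∧ g) + χ (s ∧ u ∧ g) + χ (s ∧ t ∧ g)
χ-distance-one true  true  true  false refl _  = refl
χ-distance-one true  true  true  true  refl ()
χ-distance-one true  true  false true  refl _  = refl
χ-distance-one true  true  false false refl _  = refl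
χ-distance-one true  false true  true  refl _  = refl
χ-distance-one true  false true  false refl _  = refl
χ-distance-one false true  true  true  refl _  = refl
χ-distance-one false true  true  false refl _  = refl
χ-distance-one true  false false _     refl _  = refl
χ-distance-one false true  false _     refl _  = refl
χ-distance-one false false true  _     refl _  = refl
χ-distance-one false false false _     refl _  = refl

module _ {q ℓ} {Q : Pred (Vertex q) ℓ} (Q? : Decidable Q) where

  χ? : Vertex q → ℤ
  χ? y = χ (does (Q? y))

  count-neighbours : ∀ a b c → ¬ Q (a , b , c) →
    + length (filter (λ y → adj? (a , b , c) y ×-dec Q? y) (vertices q))
      ≡ ∑[ a′ < q ] χ? (a′ , b , c) + ∑[ b′ < q ] χ? (a , b′ , c) + ∑[ c′ < q ] χ? (a , b , c′)
  count-neighbours a b c ¬Qx = begin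
    + length (filter adjQ? (vertices q))
      ≡⟨ length-filter-vertices adjQ? ⟩
    ∑[ a′ < q ] ∑[ b′ < q ] ∑[ c′ < q ] χ (does (adjQ? (a′ , b′ , c′)))
      ≡⟨ sum-cong-≗ (λ a′ → sum-cong-≗ λ b′ → trans (sum-cong-≗ (split a′ b′)) (collapse-c a′ b′)) ⟩
    ∑[ a′ < q ] ∑[ b′ < q ] (δ b b′ * g a′ b′ c + δ a a′ * g a′ b′ c + δ a a′ * (δ b b′ * ∑[ c′ < q ] g a′ b′ c′))
      ≡⟨ sum-cong-≗ collapse-b ⟩
    ∑[ a′ < q ] (g a′ b c + δ a a′ * ∑[ b′ < q ] g a′ b′ c + δ a a′ * ∑[ c′ < q ] g a′ b c′)
      ≡⟨ collapse-a ⟩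
    ∑[ a′ < q ] g a′ b c + ∑[ b′ < q ] g a b′ c + ∑[ c′ < q ] g a b c′ ∎
    where
    g : Fin q → Fin q → Fin q → ℤ
    g a′ b′ c′ = χ? (a′ , b′ , c′)

    adjQ? : Decidable (λ y → Adj (a , b , c) y × Q y)
    adjQ? y = adj? (a , b , c) y ×-dec Q? y

    x-fails : ∀ a′ b′ c′ → (does (a ≟ a′) ∧ does (b ≟ b′) ∧ does (c ≟ c′)) ∧ does (Q? (a′ , b′ , c′)) ≡ false
    x-fails a′ b′ c′ with a ≟ a′ | b ≟ b′ | c ≟ c′
    ... | yes refl | yes refl | yes refl = dec-false (Q? (a , b , c)) ¬Qx
    ... | no _     | _        | _        = refl
    ... | yes _    | no _     | _        = refl
    ... | yes _    | yes _    | no _     = refl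

    split : ∀ a′ b′ c′ → χ (does (adjQ? (a′ , b′ , c′)))
      ≡ δ b b′ * (δ c c′ * g a′ b′ c′) + δ a a′ * (δ c c′ * g a′ b′ c′) + δ a a′ * (δ b b′ * g a′ b′ c′)
    split a′ b′ c′ = trans
      (χ-distance-one s t u (does (Q? y))
        (length-filter-tabulate (λ i → ¬? (coord x i ≟ coord y i)) id) (x-fails a′ b′ c′))
      (cong₂ _+_ (cong₂ _+_ (χ-∧₃ t u _) (χ-∧₃ s u _)) (χ-∧₃ s t _))
      where
      x y : Vertex q
      x = (a , b , c)
      y = (a′ , b′ , c′)
      s t u : Bool
      s = does (a ≟ a′)
      t = does (b ≟ b′)
      u = does (c ≟ c′)

    collapse-c : ∀ a′ b′ →
      ∑[ c′ < q ] (δ b b′ * (δ c c′ * g a′ b′ c′) + δ a a′ * (δ c c′ * g a′ b′ c′) + δ a a′ * (δ b b′ * g a′ b′ c′))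
        ≡ δ b b′ * g a′ b′ c + δ a a′ * g a′ b′ c + δ a a′ * (δ b b′ * ∑[ c′ < q ] g a′ b′ c′)
    collapse-c a′ b′ = trans
      (∑-distrib-+₃ (λ c′ → δ b b′ * (δ c c′ * g a′ b′ c′)) (λ c′ → δ a a′ * (δ c c′ * g a′ b′ c′))
                    (λ c′ → δ a a′ * (δ b b′ * g a′ b′ c′)))
      (cong₂ _+_ (cong₂ _+_ (∑-*δ (δ b b′) c (g a′ b′)) (∑-*δ (δ a a′) c (g a′ b′)))
                 (trans (∑-*ˡ (δ a a′) (λ c′ → δ b b′ * g a′ b′ c′)) (cong (_*_ (δ a a′)) (∑-*ˡ (δ b b′) (g a′ b′)))))

    collapse-b : ∀ a′ →
      ∑[ b′ < q ] (δ b b′ * g a′ b′ c + δ a a′ * g a′ b′ c + δ a a′ * (δ b b′ * ∑[ c′ < q ] g a′ b′ c′))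
        ≡ g a′ b c + δ a a′ * ∑[ b′ < q ] g a′ b′ c + δ a a′ * ∑[ c′ < q ] g a′ b c′
    collapse-b a′ = trans
      (∑-distrib-+₃ (λ b′ → δ b b′ * g a′ b′ c) (λ b′ → δ a a′ * g a′ b′ c)
                    (λ b′ → δ a a′ * (δ b b′ * ∑[ c′ < q ] g a′ b′ c′)))
      (cong₂ _+_ (cong₂ _+_ (∑-δ b (λ b′ → g a′ b′ c)) (∑-*ˡ (δ a a′) (λ b′ → g a′ b′ c)))
                 (∑-*δ (δ a a′) b (λ b′ → ∑[ c′ < q ] g a′ b′ c′)))

    collapse-a : ∑[ a′ < q ] (g a′ b c + δ a a′ * ∑[ b′ < q ] g a′ b′ c + δ a a′ * ∑[ c′ < q ] g a′ b c′)
                   ≡ ∑[ a′ < q ] g a′ b c + ∑[ b′ < q ] g a b′ c + ∑[ c′ < q ] g a b c′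
    collapse-a = trans
      (∑-distrib-+₃ (λ a′ → g a′ b c) (λ a′ → δ a a′ * ∑[ b′ < q ] g a′ b′ c)
                    (λ a′ → δ a a′ * ∑[ c′ < q ] g a′ b c′))
      (cong₂ _+_ (cong (_+_ (∑[ a′ < q ] g a′ b c)) (∑-δ a (λ a′ → ∑[ b′ < q ] g a′ b′ c)))
                 (∑-δ a (λ a′ → ∑[ c′ < q ] g a′ b c′)))

module LineSums {q : ℕ} (f : Fin q → Fin q → Fin q → ℤ) where

  line₀ : Fin q → Fin q → ℤ
  line₀ b c = ∑[ a < q ] f a b c

  line₁ : Fin q → Fin q → ℤ
  line₁ a c = ∑[ b < q ] f a b c

  line₂ : Fin q → Fin q → ℤ
  line₂ a b = ∑[ c < q ] f a b c

  plane₀ : Fin q → ℤ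
  plane₀ a = ∑[ b < q ] ∑[ c < q ] f a b c

  plane₁ : Fin q → ℤ
  plane₁ b = ∑[ a < q ] ∑[ c < q ] f a b c

  plane₂ : Fin q → ℤ
  plane₂ c = ∑[ a < q ] ∑[ b < q ] f a b c

  lines : Fin q → Fin q → Fin q → ℤ
  lines a b c = line₀ b c + line₁ a c + line₂ a b

  planes : Fin q → Fin q → Fin q → ℤ
  planes a b c = plane₀ a + plane₁ b + plane₂ c

  ∑₀-lines : ∀ b c → ∑[ a < q ] lines a b c ≡ + q * line₀ b c + plane₂ c + plane₁ b
  ∑₀-lines b c = trans (∑-distrib-+₃ (λ _ → line₀ b c) (λ a → line₁ a c) (λ a → line₂ a b))
    (cong (λ s → s + plane₂ c + plane₁ b) (∑-const q (line₀ b c)))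

  ∑₁-lines : ∀ a c → ∑[ b < q ] lines a b c ≡ plane₂ c + + q * line₁ a c + plane₀ a
  ∑₁-lines a c = trans (∑-distrib-+₃ (λ b → line₀ b c) (λ _ → line₁ a c) (λ b → line₂ a b))
    (cong₂ (λ s t → s + t + plane₀ a) (∑-comm (λ b a → f a b c)) (∑-const q (line₁ a c)))

  ∑₂-lines : ∀ a b → ∑[ c < q ] lines a b c ≡ plane₁ b + plane₀ a + + q * line₂ a b
  ∑₂-lines a b = trans (∑-distrib-+₃ (λ c → line₀ b c) (λ c → line₁ a c) (λ _ → line₂ a b))
    (cong₂ _+_ (cong₂ _+_ (∑-comm (λ c a → f a b c)) (∑-comm (λ c b → f a b c))) (∑-const q (line₂ a b)))

  ∑-lines : ∀ a b c → ∑[ a′ < q ] lines a′ b c + ∑[ b′ < q ] lines a b′ c + ∑[ c′ < q ] lines a b c′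
                     ≡ + q * lines a b c + + 2 * planes a b c
  ∑-lines a b c = begin
    ∑[ a′ < q ] lines a′ b c + ∑[ b′ < q ] lines a b′ c + ∑[ c′ < q ] lines a b c′
      ≡⟨ cong₂ _+_ (cong₂ _+_ (∑₀-lines b c) (∑₁-lines a c)) (∑₂-lines a b) ⟩
    (+ q * line₀ b c + plane₂ c + plane₁ b) + (plane₂ c + + q * line₁ a c + plane₀ a)
      + (plane₁ b + plane₀ a + + q * line₂ a b)
      ≡⟨ regroup (+ q) (line₀ b c) (line₁ a c) (line₂ a b) (plane₀ a) (plane₁ b) (plane₂ c) ⟩
    + q * lines a b c + + 2 * planes a b c ∎
    where
    regroup : ∀ Q l₀ l₁ l₂ P₀ P₁ P₂ →
      (Q * l₀ + P₂ + P₁) + (P₂ + Q * l₁ + P₀) + (P₁ + P₀ + Q * l₂) ≡ Q * (l₀ + l₁ + l₂) + + 2 * (P₀ + P₁ + P₂)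
    regroup = solve-∀

  module Affine (K γ : ℤ) (lines-affine : ∀ a b c → lines a b c ≡ f a b c * K + γ) where

    ∑₀-lines-affine : ∀ b c → ∑[ a < q ] lines a b c ≡ line₀ b c * K + + q * γ
    ∑₀-lines-affine b c = trans (sum-cong-≗ λ a → lines-affine a b c) (∑-affine (λ a → f a b c) K γ)

    ∑₁-lines-affine : ∀ a c → ∑[ b < q ] lines a b c ≡ line₁ a c * K + + q * γ
    ∑₁-lines-affine a c = trans (sum-cong-≗ λ b → lines-affine a b c) (∑-affine (λ b → f a b c) K γ)

    ∑₂-lines-affine : ∀ a b → ∑[ c < q ] lines a b c ≡ line₂ a b * K + + q * γ
    ∑₂-lines-affine a b = trans (sum-cong-≗ λ c → lines-affine a b c) (∑-affine (λ c → f a b c) K γ)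

    plane₁+plane₂ : ∀ b c → plane₁ b + plane₂ c ≡ (K - + q) * line₀ b c + + q * γ
    plane₁+plane₂ b c = begin
      plane₁ b + plane₂ c                               ≡⟨ isolate (+ q) (line₀ b c) (plane₁ b) (plane₂ c) ⟩
      (+ q * line₀ b c + plane₂ c + plane₁ b) - + q * line₀ b c
        ≡⟨ cong (λ s → s - + q * line₀ b c) (trans (sym (∑₀-lines b c)) (∑₀-lines-affine b c)) ⟩
      (line₀ b c * K + + q * γ) - + q * line₀ b c        ≡⟨ collect (+ q) (line₀ b c) K γ ⟩
      (K - + q) * line₀ b c + + q * γ                   ∎
      where
      isolate : ∀ Q l P₁ P₂ → P₁ + P₂ ≡ (Q * l + P₂ + P₁) - Q * l
      isolate = solve-∀
      collect : ∀ Q l K γ → (l * K + Q * γ) - Q * l ≡ (K - Q) * l + Q * γ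
      collect = solve-∀

    twice-planes : ∀ a b c → + 2 * planes a b c ≡ (K - + q) * lines a b c + + 3 * (+ q * γ)
    twice-planes a b c = begin
      + 2 * planes a b c
        ≡⟨ isolate (+ q) (lines a b c) (planes a b c) ⟩
      (+ q * lines a b c + + 2 * planes a b c) - + q * lines a b c
        ≡⟨ cong (λ s → s - + q * lines a b c) (sym (∑-lines a b c)) ⟩
      (∑[ a′ < q ] lines a′ b c + ∑[ b′ < q ] lines a b′ c + ∑[ c′ < q ] lines a b c′) - + q * lines a b c
        ≡⟨ cong (λ s → s - + q * lines a b c)
             (cong₂ _+_ (cong₂ _+_ (∑₀-lines-affine b c) (∑₁-lines-affine a c)) (∑₂-lines-affine a b)) ⟩
      ((line₀ b c * K + + q * γ) + (line₁ a c * K + + q * γ) + (line₂ a b * K + + q * γ)) - + q * lines a b c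
        ≡⟨ collect (+ q) (line₀ b c) (line₁ a c) (line₂ a b) K γ ⟩
      (K - + q) * lines a b c + + 3 * (+ q * γ) ∎
      where
      isolate : ∀ Q L P → + 2 * P ≡ (Q * L + + 2 * P) - Q * L
      isolate = solve-∀
      collect : ∀ Q l₀ l₁ l₂ K γ → ((l₀ * K + Q * γ) + (l₁ * K + Q * γ) + (l₂ * K + Q * γ)) - Q * (l₀ + l₁ + l₂)
                                  ≡ (K - Q) * (l₀ + l₁ + l₂) + + 3 * (Q * γ)
      collect = solve-∀

    planes-cong : ∀ {a b c a′ b′ c′} → f a b c ≡ f a′ b′ c′ → planes a b c ≡ planes a′ b′ c′
    planes-cong {a} {b} {c} {a′} {b′} {c′} eq = ℤ.*-cancelˡ-≡ (+ 2) _ _ (begin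
      + 2 * planes a b c                                       ≡⟨ twice-planes a b c ⟩
      (K - + q) * lines a b c + + 3 * (+ q * γ)
        ≡⟨ cong (λ L → (K - + q) * L + + 3 * (+ q * γ)) lines-eq ⟩
      (K - + q) * lines a′ b′ c′ + + 3 * (+ q * γ)             ≡⟨ twice-planes a′ b′ c′ ⟨
      + 2 * planes a′ b′ c′                                    ∎)
      where
      lines-eq : lines a b c ≡ lines a′ b′ c′
      lines-eq = trans (lines-affine a b c) (trans (cong (λ v → v * K + γ) eq) (sym (lines-affine a′ b′ c′)))

    line₀-scaled-constant : ∀ {a₁ c₁ a₂ b₂} → (∀ b b′ → f a₁ b c₁ ≡ f a₁ b′ c₁) → (∀ c c′ → f a₂ b₂ c ≡ f a₂ b₂ c′) →
      ∀ b c b′ c′ → (K - + q) * line₀ b c ≡ (K - + q) * line₀ b′ c′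
    line₀-scaled-constant {a₁} {c₁} {a₂} {b₂} f-const₁ f-const₂ b c b′ c′ = ∙-cancelʳ (+ q * γ) _ _ (begin
      (K - + q) * line₀ b c + + q * γ    ≡⟨ plane₁+plane₂ b c ⟨
      plane₁ b + plane₂ c                ≡⟨ cong₂ _+_ (plane₁-constant b b′) (plane₂-constant c c′) ⟩
      plane₁ b′ + plane₂ c′              ≡⟨ plane₁+plane₂ b′ c′ ⟩
      (K - + q) * line₀ b′ c′ + + q * γ  ∎)
      where
      plane₁-constant : ∀ b b′ → plane₁ b ≡ plane₁ b′
      plane₁-constant b b′ = ∙-cancelˡ (plane₀ a₁) _ _ (∙-cancelʳ (plane₂ c₁) _ _ (planes-cong (f-const₁ b b′)))
      plane₂-constant : ∀ c c′ → plane₂ c ≡ plane₂ c′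
      plane₂-constant c c′ = ∙-cancelˡ (plane₀ a₂ + plane₁ b₂) _ _ (planes-cong (f-const₂ c c′))

⟦_⟧ : ∀ {q} → Code q → Fin q → Fin q → Fin q → ℤ
⟦ C ⟧ a b c = χ (C (a , b , c))

module _ {q} (C : Code q) where
  open LineSums ⟦ C ⟧

  χ-inC-true : ∀ y → χ? (inC? C true) y ≡ χ (C y)
  χ-inC-true y with C y
  ... | true = refl
  ... | false = refl

  χ-inC-false : ∀ y → χ? (inC? C false) y ≡ 1ℤ - χ (C y)
  χ-inC-false y with C y
  ... | true = refl
  ... | false = refl

  nbrsWith-true : ∀ a b c → C (a , b , c) ≡ false → + nbrsWith C true (a , b , c) ≡ lines a b c
  nbrsWith-true a b c x∉C = trans (count-neighbours (inC? C true) a b c (Bool.not-¬ x∉C))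
    (cong₂ _+_ (cong₂ _+_ (sum-cong-≗ λ a′ → χ-inC-true (a′ , b , c))
                          (sum-cong-≗ λ b′ → χ-inC-true (a , b′ , c)))
               (sum-cong-≗ λ c′ → χ-inC-true (a , b , c′)))

  nbrsWith-false : ∀ a b c → C (a , b , c) ≡ true → + nbrsWith C false (a , b , c) ≡ + 3 * + q - lines a b c
  nbrsWith-false a b c x∈C = begin
    + nbrsWith C false (a , b , c)
      ≡⟨ count-neighbours (inC? C false) a b c (Bool.not-¬ x∈C) ⟩
    _ ≡⟨ cong₂ _+_ (cong₂ _+_ (complement (λ a′ → (a′ , b , c))) (complement (λ b′ → (a , b′ , c))))
                   (complement (λ c′ → (a , b , c′))) ⟩
    (+ q - line₀ b c) + (+ q - line₁ a c) + (+ q - line₂ a b)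
      ≡⟨ regroup (+ q) (line₀ b c) (line₁ a c) (line₂ a b) ⟩
    + 3 * + q - lines a b c ∎
    where
    complement : (g : Fin q → Vertex q) → ∑[ i < q ] χ? (inC? C false) (g i) ≡ + q - ∑[ i < q ] χ (C (g i))
    complement g = trans (sum-cong-≗ (χ-inC-false ∘ g)) (∑-complement (λ i → χ (C (g i))))
    regroup : ∀ Q l₀ l₁ l₂ → (Q - l₀) + (Q - l₁) + (Q - l₂) ≡ + 3 * Q - (l₀ + l₁ + l₂)
    regroup = solve-∀

  crc-lines-affine : ∀ {β γ} → IsCRC1 C β γ → ∀ a b c → lines a b c ≡ ⟦ C ⟧ a b c * (+ 3 * + q - + β - + γ) + + γ
  crc-lines-affine {β} {γ} (_ , _ , _ , _ , β-nbrs , γ-nbrs) a b c with C (a , b , c) in Cx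
  ... | false = trans (sym (nbrsWith-true a b c Cx)) (cong +_ (γ-nbrs (a , b , c) Cx))
  ... | true = begin
    lines a b c                                 ≡⟨ solve-for-lines (+ 3 * + q) (lines a b c) ⟩
    + 3 * + q - (+ 3 * + q - lines a b c)       ≡⟨ cong (λ n → + 3 * + q - n) (nbrsWith-false a b c Cx) ⟨
    + 3 * + q - + nbrsWith C false (a , b , c)  ≡⟨ cong (λ n → + 3 * + q - + n) (β-nbrs (a , b , c) Cx) ⟩
    + 3 * + q - + β                             ≡⟨ regroup (+ 3 * + q) (+ β) (+ γ) ⟩
    1ℤ * (+ 3 * + q - + β - + γ) + + γ          ∎
    where
    solve-for-lines : ∀ N L → L ≡ N - (N - L)
    solve-for-lines = solve-∀
    regroup : ∀ N B G → N - B ≡ 1ℤ * (N - B - G) + G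
    regroup = solve-∀

replace : ∀ {q} → Vertex q → Fin 3 → Fin q → Vertex q
replace (a , b , c) zero s = (s , b , c)
replace (a , b , c) (suc zero) s = (a , s , c)
replace (a , b , c) (suc (suc zero)) s = (a , b , s)

replace-inClique : ∀ {q} (x : Vertex q) i s → InClique (replace x i s) (i , x)
replace-inClique x zero s zero j≢i = ⊥-elim (j≢i refl)
replace-inClique x zero s (suc zero) _ = refl
replace-inClique x zero s (suc (suc zero)) _ = refl
replace-inClique x (suc zero) s zero _ = refl
replace-inClique x (suc zero) s (suc zero) j≢i = ⊥-elim (j≢i refl)
replace-inClique x (suc zero) s (suc (suc zero)) _ = refl
replace-inClique x (suc (suc zero)) s zero _ = refl
replace-inClique x (suc (suc zero)) s (suc zero) _ = refl
replace-inClique x (suc (suc zero)) s (suc (suc zero)) j≢i = ⊥-elim (j≢i refl)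

full-line : ∀ {q} {C : Code q} → StrongClique C → ∀ i → ∃[ x ] ∀ s → C (replace x i s) ≡ true
full-line (cliques , _ , covered , _ , codirections) i with find (codirections i)
... | (.i , x) , k∈cliques , refl =
  x , λ s → covered (replace x i s) (i , x) k∈cliques (replace-inClique x i s)

lemma1 : (q : ℕ) → q ≥ 2 → (C : Code q) (β γ : ℕ) →
    IsCRC1 C β γ → StrongClique C → β ℕ.+ γ ≡ 2 ℕ.* q
lemma1 q _ C β γ crc@(_ , ((y₀ , y₁ , y₂) , y∉C) , _) strong = ℤ.+-injective (begin
  + (β ℕ.+ γ)            ≡⟨ ℤ.pos-+ β γ ⟩
  + β + + γ              ≡⟨ rearrange (+ q) (+ β) (+ γ) ⟩
  + 2 * + q - (K - + q)  ≡⟨ cong (λ d → + 2 * + q - d) K-q≡0 ⟩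
  + 2 * + q - 0ℤ         ≡⟨ ℤ.+-identityʳ (+ 2 * + q) ⟩
  + 2 * + q              ≡⟨ ℤ.pos-* 2 q ⟨
  + (2 ℕ.* q)            ∎)
  where
  K : ℤ
  K = + 3 * + q - + β - + γ

  rearrange : ∀ Q B G → B + G ≡ + 2 * Q - ((+ 3 * Q - B - G) - Q)
  rearrange = solve-∀

  open LineSums ⟦ C ⟧
  open Affine K (+ γ) (crc-lines-affine C crc)

  K-q≡0 : K - + q ≡ 0ℤ
  K-q≡0 with K - + q ℤ.≟ 0ℤ | full-line strong zero | full-line strong (suc zero) | full-line strong (suc (suc zero))
  ... | yes K-q≡0 | _ | _ | _ = K-q≡0
  ... | no K-q≢0 | (_ , b , c) , full₀ | _ , full₁ | _ , full₂ =
    ⊥-elim (ℤ.<-irrefl line-through-y-full (∑-χ-< (λ a → C (a , y₁ , y₂)) y₀ y∉C))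
    where
    instance _ = ≢-nonZero K-q≢0

    constant : ∀ {g : Fin q → Bool} → (∀ s → g s ≡ true) → ∀ s s′ → χ (g s) ≡ χ (g s′)
    constant full s s′ = cong χ (trans (full s) (sym (full s′)))

    line-through-y-full : line₀ y₁ y₂ ≡ + q
    line-through-y-full = ℤ.*-cancelˡ-≡ (K - + q) _ _ (begin
      (K - + q) * line₀ y₁ y₂  ≡⟨ line₀-scaled-constant (constant full₁) (constant full₂) y₁ y₂ b c ⟩
      (K - + q) * line₀ b c    ≡⟨ cong (_*_ (K - + q)) (∑-χ-all (λ a → C (a , b , c)) full₀) ⟩
      (K - + q) * + q          ∎)
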